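{- Let $H\subseteq\operatorname{GL}_2(\mathbb{Z}_2)$ be a closed subgroup such that the reduction map $H\to\operatorname{GL}_2(\mathbb{Z}/4\mathbb{Z})$ is surjective and $(\operatorname{sgn},\det)(H)=\{\pm1\}\times\mathbb{Z}_2^*$. Then $H=\operatorname{GL}_2(\mathbb{Z}_2)$.
   Context: $\operatorname{sgn}\colon\operatorname{GL}_2(\mathbb{Z}_2)\to\{\pm1\}$ is the composition of reduction mod $2$ to $\operatorname{GL}_2(\mathbb{F}_2)$, the identification $\operatorname{GL}_2(\mathbb{F}_2)\simeq\mathfrak{S}_3$ via the action on the three nonzero vectors of $\mathbb{F}_2^2$, and the sign of a permutation. -}

module Defs where

open import Data.Nat using (ℕ; zero; suc; _+_; _*_; _^_; _%_; NonZero; _<ᵇ_; _≡ᵇ_)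
open import Data.Nat.Properties using (m^n≢0)
open import Data.Fin using (Fin; zero; suc; toℕ)
open import Data.Product using (Σ; _×_; _,_)
open import Data.Sign using (Sign)
open import Data.Bool using (if_then_else_)
open import Relation.Binary.PropositionalEquality using (_≡_; refl)


Cong : ℕ → ℕ → ℕ → Set
Cong n x y = _%_ x (2 ^ n) {{m^n≢0 2 n}} ≡ _%_ y (2 ^ n) {{m^n≢0 2 n}}

-- raw sequences; the n-th term is read modulo 2^n
Seq : Set
Seq = ℕ → ℕ

infix 4 _≈ₛ_ _≈M_ _≈₂_
infixl 7 _*ₛ_ _·_
infixl 6 _+ₛ_

_≈ₛ_ : Seq → Seq → Set
x ≈ₛ y = ∀ n → Cong n (x n) (y n)

_+ₛ_ : Seq → Seq → Seq
(x +ₛ y) n = x n + y n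

_*ₛ_ : Seq → Seq → Seq
(x *ₛ y) n = x n * y n

constₛ : ℕ → Seq
constₛ k _ = k

-- 2-adic integers ℤ₂ = lim ℤ/2^n, as coherent sequences (equality is ≈ₛ)
record ℤ₂ : Set where
  constructor mkℤ₂
  field
    seq : Seq
    coh : ∀ n → Cong n (seq (suc n)) (seq n)
open ℤ₂ public

_≈₂_ : ℤ₂ → ℤ₂ → Set
x ≈₂ y = seq x ≈ₛ seq y

IsUnit : ℤ₂ → Set
IsUnit u = Σ ℤ₂ λ v → (seq u *ₛ seq v) ≈ₛ constₛ 1

record M2 : Set where
  constructor mkM2
  field
    a b c d : ℤ₂
open M2 public

record SM : Set where
  constructor mkSM
  field
    sa sb sc sd : Seq
open SM public

toSM : M2 → SM
toSM g = mkSM (seq (a g)) (seq (b g)) (seq (c g)) (seq (d g))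

_≈M_ : SM → SM → Set
X ≈M Y = (sa X ≈ₛ sa Y) × (sb X ≈ₛ sb Y) × (sc X ≈ₛ sc Y) × (sd X ≈ₛ sd Y)

mulSM : SM → SM → SM
mulSM X Y = mkSM ((sa X *ₛ sa Y) +ₛ (sb X *ₛ sc Y)) ((sa X *ₛ sb Y) +ₛ (sb X *ₛ sd Y))
                 ((sc X *ₛ sa Y) +ₛ (sd X *ₛ sc Y)) ((sc X *ₛ sb Y) +ₛ (sd X *ₛ sd Y))

_·_ : M2 → M2 → SM
g · h = mulSM (toSM g) (toSM h)

ISM : SM
ISM = mkSM (constₛ 1) (constₛ 0) (constₛ 0) (constₛ 1)

I₂ : M2
I₂ = mkM2 (mkℤ₂ (constₛ 1) (λ _ → refl)) (mkℤ₂ (constₛ 0) (λ _ → refl))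
          (mkℤ₂ (constₛ 0) (λ _ → refl)) (mkℤ₂ (constₛ 1) (λ _ → refl))

IsGL2 : M2 → Set
IsGL2 g = Σ M2 λ k → (g · k ≈M ISM) × (k · g ≈M ISM)

-- det g = u, written as  a d ≡ u + b c  (avoiding subtraction in ℕ)
HasDet : M2 → ℤ₂ → Set
HasDet g u = (seq (a g) *ₛ seq (d g)) ≈ₛ (seq u +ₛ (seq (b g) *ₛ seq (c g)))

CongM : ℕ → M2 → M2 → Set
CongM n g h = Cong n (seq (a g) n) (seq (a h) n) × Cong n (seq (b g) n) (seq (b h) n)
            × Cong n (seq (c g) n) (seq (c h) n) × Cong n (seq (d g) n) (seq (d h) n)

-- sgn : GL₂(ℤ₂) → GL₂(𝔽₂) ≃ 𝔖₃ → {±1}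
-- nonzero vectors of 𝔽₂²: 0 ↦ (1,0), 1 ↦ (0,1), 2 ↦ (1,1)

vx vy : Fin 3 → ℕ
vx zero = 1
vx (suc zero) = 0
vx (suc (suc zero)) = 1
vy zero = 0
vy (suc zero) = 1
vy (suc (suc zero)) = 1

code : ℕ → ℕ → Fin 3
code 1 0 = zero
code 0 1 = suc zero
code _ _ = suc (suc zero)   -- (1,1); (0,0) never occurs for invertible g

bit : ℤ₂ → ℕ
bit x = seq x 1 % 2

-- permutation of the nonzero vectors induced by g mod 2 (column vectors)
perm : M2 → Fin 3 → Fin 3
perm g i = code ((bit (a g) * vx i + bit (b g) * vy i) % 2)
                ((bit (c g) * vx i + bit (d g) * vy i) % 2)

inv : (Fin 3 → Fin 3) → Fin 3 → Fin 3 → ℕ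
inv σ i j = if toℕ (σ j) <ᵇ toℕ (σ i) then 1 else 0

inversions : (Fin 3 → Fin 3) → ℕ
inversions σ = inv σ zero (suc zero) + inv σ zero (suc (suc zero))
             + inv σ (suc zero) (suc (suc zero))

permSign : (Fin 3 → Fin 3) → Sign
permSign σ = if (inversions σ % 2) ≡ᵇ 0 then Sign.+ else Sign.-

sgn : M2 → Sign
sgn g = permSign (perm g)

record IsClosedSubgroup (H : M2 → Set) : Set where
  field
    respects : ∀ g h → toSM g ≈M toSM h → H g → H h
    ⊆GL2     : ∀ g → H g → IsGL2 g
    has-one  : H I₂
    mul-cl   : ∀ g h k → H g → H h → toSM k ≈M (g · h) → H k
    inv-cl   : ∀ g k → H g → (g · k ≈M ISM) → H k
    closed   : ∀ g → IsGL2 g → (∀ n → Σ M2 λ h → H h × CongM n h g) → H g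

-- H → GL₂(ℤ/4ℤ) is surjective (entries of GL₂(ℤ/4) represented by naturals mod 4)
InvMod4 : ℕ → ℕ → ℕ → ℕ → Set
InvMod4 p q r s = Σ ℕ λ p' → Σ ℕ λ q' → Σ ℕ λ r' → Σ ℕ λ s' →
  (Cong 2 (p * p' + q * r') 1 × Cong 2 (p * q' + q * s') 0
   × Cong 2 (r * p' + s * r') 0 × Cong 2 (r * q' + s * s') 1)
  × (Cong 2 (p' * p + q' * r) 1 × Cong 2 (p' * q + q' * s) 0
   × Cong 2 (r' * p + s' * r) 0 × Cong 2 (r' * q + s' * s) 1)

Red4Surj : (M2 → Set) → Set
Red4Surj H = ∀ p q r s → InvMod4 p q r s →
  Σ M2 λ g → H g × Cong 2 (seq (a g) 2) p × Cong 2 (seq (b g) 2) q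
                 × Cong 2 (seq (c g) 2) r × Cong 2 (seq (d g) 2) s

-- (sgn, det)(H) ⊇ {±1} × ℤ₂^*   (⊆ holds automatically)
SgnDetSurj : (M2 → Set) → Set
SgnDetSurj H = ∀ (s : Sign) (u : ℤ₂) → IsUnit u →
  Σ M2 λ g → H g × (sgn g ≡ s) × HasDet g u

module Submission where

-- As H is closed, it suffices that H maps onto every GL₂(ℤ/2ⁿ). Surjectivity at level n lifts to
-- level n+1 once H maps onto the kernel {I + 2ⁿX} of GL₂(ℤ/2ⁿ⁺¹) → GL₂(ℤ/2ⁿ) (`refine`), and for
-- n ≥ 2 squaring carries I + 2ⁿX to I + 2ⁿ⁺¹X (`square-lift`); so all reduces to the classes
-- I + 4X (mod 8), X ∈ M₂(𝔽₂). These X form an additive group (`product-mod8`) containing N + N²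
-- whenever I + 2N is invertible mod 4 (squares of lifts), hence the trace-zero matrices. An X of odd
-- trace comes from g ∈ H with sgn g = +1, det g = −1/3 ≡ 5 (mod 8): mod 4, g ≡ N₁²N₂² (a finite
-- check), and if y ∈ H is a product of squares of lifts, y⁻¹g ≡ I + 4X has det ≡ 5, so tr X is odd.

open import Defs
open import Data.Nat as ℕ using (ℕ; zero; suc; _^_; NonZero)
import Data.Nat.Properties as ℕP
import Data.Nat.DivMod as ℕD
open import Data.Nat.Divisibility using (divides)
open import Data.Integer as ℤ using (ℤ; +_; -[1+_]; _+_; _*_; -_; _-_)
import Data.Integer.Properties as ℤP
import Data.Integer.DivMod as ℤD
open import Data.Integer.Tactic.RingSolver using (solve-∀)
open import Data.Product using (Σ; _×_; _,_; proj₁; proj₂)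
open import Data.Sum using (_⊎_; inj₁; inj₂)
open import Data.Unit using (tt)
open import Data.Fin using (Fin; toℕ; fromℕ<)
open import Data.Fin.Properties using (all?; toℕ-fromℕ<)
open import Data.Sign using (Sign)
import Data.Sign.Properties as SignP
open import Relation.Nullary.Decidable using (Dec; _×-dec_; _→-dec_; toWitness)
open import Relation.Binary.PropositionalEquality
open import Relation.Binary.Bundles using (Setoid)
import Relation.Binary.Reasoning.Setoid as SetoidReasoning

pow2 : ℕ → ℤ
pow2 n = + (2 ^ n)

pow2-suc : ∀ n → pow2 (suc n) ≡ + 2 * pow2 n
pow2-suc n = ℤP.pos-* 2 (2 ^ n)

pow2-+ : ∀ k n → pow2 (k ℕ.+ n) ≡ pow2 k * pow2 n
pow2-+ k n = trans (cong +_ (ℕP.^-distribˡ-+-* 2 k n)) (ℤP.pos-* (2 ^ k) (2 ^ n))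

infix 4 _≡[_]_
record _≡[_]_ (x : ℤ) (n : ℕ) (y : ℤ) : Set where
  constructor by
  field
    quot : ℤ
    eqn  : x ≡ y + pow2 n * quot

module _ {n : ℕ} where

  c-≡ : ∀ {x y} → x ≡ y → x ≡[ n ] y
  c-≡ {x} refl = by (+ 0) (sym (trans (cong (λ t → x + t) (ℤP.*-zeroʳ (pow2 n))) (ℤP.+-identityʳ x)))

  c-refl : ∀ {x} → x ≡[ n ] x
  c-refl = c-≡ refl

  c-sym : ∀ {x y} → x ≡[ n ] y → y ≡[ n ] x
  c-sym {y = y} (by q e) = by (- q) (trans (ring y q (pow2 n)) (cong (λ t → t + pow2 n * (- q)) (sym e)))
    where ring : ∀ y q p → y ≡ (y + p * q) + p * (- q)
          ring = solve-∀

  c-trans : ∀ {x y z} → x ≡[ n ] y → y ≡[ n ] z → x ≡[ n ] z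
  c-trans {z = z} (by q e) (by r f) =
    by (r + q) (trans e (trans (cong (λ t → t + pow2 n * q) f) (ring z r q (pow2 n))))
    where ring : ∀ z r q p → (z + p * r) + p * q ≡ z + p * (r + q)
          ring = solve-∀

  c-+ : ∀ {x x' y y'} → x ≡[ n ] x' → y ≡[ n ] y' → x + y ≡[ n ] x' + y'
  c-+ {x' = x'} {y' = y'} (by q e) (by r f) =
    by (q + r) (trans (cong₂ _+_ e f) (ring x' y' q r (pow2 n)))
    where ring : ∀ x' y' q r p → (x' + p * q) + (y' + p * r) ≡ (x' + y') + p * (q + r)
          ring = solve-∀

  c-* : ∀ {x x' y y'} → x ≡[ n ] x' → y ≡[ n ] y' → x * y ≡[ n ] x' * y'
  c-* {x' = x'} {y' = y'} (by q e) (by r f) =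
    by (x' * r + q * y' + pow2 n * q * r) (trans (cong₂ _*_ e f) (ring x' y' q r (pow2 n)))
    where ring : ∀ x' y' q r p → (x' + p * q) * (y' + p * r) ≡ x' * y' + p * (x' * r + q * y' + p * q * r)
          ring = solve-∀

  c-neg : ∀ {x y} → x ≡[ n ] y → - x ≡[ n ] - y
  c-neg {y = y} (by q e) = by (- q) (trans (cong -_ e) (ring y q (pow2 n)))
    where ring : ∀ y q p → - (y + p * q) ≡ - y + p * (- q)
          ring = solve-∀

  c-multiple : ∀ q → pow2 n * q ≡[ n ] + 0
  c-multiple q = by q (sym (ℤP.+-identityˡ (pow2 n * q)))

c-weaken : ∀ k {n x y} → x ≡[ k ℕ.+ n ] y → x ≡[ n ] y
c-weaken k {n} {y = y} (by q e) =
  by (pow2 k * q) (trans e (trans (cong (λ p → y + p * q) (pow2-+ k n)) (ring y (pow2 k) (pow2 n) q)))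
  where ring : ∀ y pk pn q → y + (pk * pn) * q ≡ y + pn * (pk * q)
        ring = solve-∀

c-scale : ∀ {k} n {x y} → x ≡[ k ] y → pow2 n * x ≡[ k ℕ.+ n ] pow2 n * y
c-scale {k} n {y = y} (by q e) =
  by q (trans (cong (pow2 n *_) e) (trans (ring y (pow2 k) (pow2 n) q) (cong (λ p → pow2 n * y + p * q) (sym (pow2-+ k n)))))
  where ring : ∀ y pk pn q → pn * (y + pk * q) ≡ pn * y + (pk * pn) * q
        ring = solve-∀

c-cancel : ∀ {k} n {x y} → pow2 n * x ≡[ k ℕ.+ n ] pow2 n * y → x ≡[ k ] y
c-cancel {k} n {x} {y} (by q e) = by q (ℤP.*-cancelˡ-≡ (pow2 n) x (y + pow2 k * q) {{ℕP.m^n≢0 2 n}}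
  (trans e (trans (cong (λ p → pow2 n * y + p * q) (pow2-+ k n)) (ring y (pow2 k) (pow2 n) q))))
  where ring : ∀ y pk pn q → pn * y + (pk * pn) * q ≡ pn * (y + pk * q)
        ring = solve-∀

c-parity : ∀ q → (q ≡[ 1 ] + 0) ⊎ (q ≡[ 1 ] + 1)
c-parity q with q ℤD.%ℕ 2 | ℤD.n%ℕd<d q 2 | ℤD.a≡a%ℕn+[a/ℕn]*n q 2
... | 0 | _ | e = inj₁ (by (q ℤD./ℕ 2) (trans e (cong (λ t → + 0 + t) (ℤP.*-comm (q ℤD./ℕ 2) (+ 2)))))
... | 1 | _ | e = inj₂ (by (q ℤD./ℕ 2) (trans e (cong (λ t → + 1 + t) (ℤP.*-comm (q ℤD./ℕ 2) (+ 2)))))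
... | suc (suc _) | ℕ.s≤s (ℕ.s≤s ()) | _

c-odd-square : ∀ {z} → z ≡[ 1 ] + 1 → z * z ≡[ 3 ] + 1
c-odd-square (by q refl) with c-parity q
... | inj₁ (by r refl) = by (r + + 2 * r * r) (ring r)
  where ring : ∀ r → (+ 1 + + 2 * (+ 0 + + 2 * r)) * (+ 1 + + 2 * (+ 0 + + 2 * r)) ≡ + 1 + + 8 * (r + + 2 * r * r)
        ring = solve-∀
... | inj₂ (by r refl) = by (+ 1 + + 3 * r + + 2 * r * r) (ring r)
  where ring : ∀ r → (+ 1 + + 2 * (+ 1 + + 2 * r)) * (+ 1 + + 2 * (+ 1 + + 2 * r)) ≡ + 1 + + 8 * (+ 1 + + 3 * r + + 2 * r * r)
        ring = solve-∀

module _ (n : ℕ) where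
  private instance
    2ⁿ≢0 : NonZero (2 ^ n)
    2ⁿ≢0 = ℕP.m^n≢0 2 n

  euclid : ∀ x → + x ≡ + (x ℕ.% 2 ^ n) + pow2 n * + (x ℕ./ 2 ^ n)
  euclid x = begin
    + x                                                    ≡⟨ cong +_ (ℕD.m≡m%n+[m/n]*n x (2 ^ n)) ⟩
    + (x ℕ.% 2 ^ n ℕ.+ x ℕ./ 2 ^ n ℕ.* 2 ^ n)              ≡⟨ ℤP.pos-+ (x ℕ.% 2 ^ n) _ ⟩
    + (x ℕ.% 2 ^ n) + + (x ℕ./ 2 ^ n ℕ.* 2 ^ n)            ≡⟨ cong (λ t → + (x ℕ.% 2 ^ n) + t) (ℤP.pos-* (x ℕ./ 2 ^ n) (2 ^ n)) ⟩
    + (x ℕ.% 2 ^ n) + + (x ℕ./ 2 ^ n) * pow2 n             ≡⟨ cong (λ t → + (x ℕ.% 2 ^ n) + t) (ℤP.*-comm (+ (x ℕ./ 2 ^ n)) (pow2 n)) ⟩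
    + (x ℕ.% 2 ^ n) + pow2 n * + (x ℕ./ 2 ^ n)             ∎
    where open ≡-Reasoning

  fromCong : ∀ {x y} → Cong n x y → + x ≡[ n ] + y
  fromCong {x} {y} e = by (+ (x ℕ./ 2 ^ n) - + (y ℕ./ 2 ^ n))
    (trans (euclid x) (trans (cong (λ r → + r + pow2 n * + (x ℕ./ 2 ^ n)) e)
      (trans (ring (+ (y ℕ.% 2 ^ n)) (+ (x ℕ./ 2 ^ n)) (+ (y ℕ./ 2 ^ n)) (pow2 n))
        (cong (λ t → t + pow2 n * (+ (x ℕ./ 2 ^ n) - + (y ℕ./ 2 ^ n))) (sym (euclid y))))))
    where ring : ∀ r u v p → r + p * u ≡ (r + p * v) + p * (u - v)
          ring = solve-∀

  natQuotient : ∀ {x y k} → + x ≡ + y + pow2 n * + k → Cong n x y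
  natQuotient {x} {y} {k} e = trans (cong (ℕ._% 2 ^ n) x≡) (ℕD.[m+kn]%n≡m%n y k (2 ^ n))
    where
    x≡ : x ≡ y ℕ.+ k ℕ.* 2 ^ n
    x≡ = ℤP.+-injective (trans e (trans (cong (λ t → + y + t) (trans (ℤP.*-comm (pow2 n) (+ k)) (sym (ℤP.pos-* k (2 ^ n)))))
                                        (sym (ℤP.pos-+ y (k ℕ.* 2 ^ n)))))

  toCong : ∀ {x y} → + x ≡[ n ] + y → Cong n x y
  toCong (by (+ k) e)       = natQuotient e
  toCong c@(by -[1+ k ] e) = sym (natQuotient (_≡[_]_.eqn (c-sym c)))

record Mat : Set where
  constructor mat
  field m₁₁ m₁₂ m₂₁ m₂₂ : ℤ
open Mat

mat-≡ : ∀ {a b c d a' b' c' d'} → a ≡ a' → b ≡ b' → c ≡ c' → d ≡ d' → mat a b c d ≡ mat a' b' c' d'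
mat-≡ refl refl refl refl = refl

infixl 7 _⊗_ _⋆_
infixl 6 _⊕_

_⊗_ : Mat → Mat → Mat
A ⊗ B = mat (m₁₁ A * m₁₁ B + m₁₂ A * m₂₁ B) (m₁₁ A * m₁₂ B + m₁₂ A * m₂₂ B)
            (m₂₁ A * m₁₁ B + m₂₂ A * m₂₁ B) (m₂₁ A * m₁₂ B + m₂₂ A * m₂₂ B)

_⊕_ : Mat → Mat → Mat
A ⊕ B = mat (m₁₁ A + m₁₁ B) (m₁₂ A + m₁₂ B) (m₂₁ A + m₂₁ B) (m₂₂ A + m₂₂ B)

_⋆_ : ℤ → Mat → Mat
x ⋆ A = mat (x * m₁₁ A) (x * m₁₂ A) (x * m₂₁ A) (x * m₂₂ A)

1M : Mat
1M = mat (+ 1) (+ 0) (+ 0) (+ 1)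

det : Mat → ℤ
det A = m₁₁ A * m₂₂ A - m₁₂ A * m₂₁ A

trace : Mat → ℤ
trace A = m₁₁ A + m₂₂ A

⊗-assoc : ∀ A B C → (A ⊗ B) ⊗ C ≡ A ⊗ (B ⊗ C)
⊗-assoc (mat a b c d) (mat e f g h) (mat i j k l) =
  mat-≡ (entry a b e f g h i k) (entry a b e f g h j l) (entry c d e f g h i k) (entry c d e f g h j l)
  where entry : ∀ a b e f g h i k → (a * e + b * g) * i + (a * f + b * h) * k ≡ a * (e * i + f * k) + b * (g * i + h * k)
        entry = solve-∀

⊗-identityˡ : ∀ A → 1M ⊗ A ≡ A
⊗-identityˡ (mat a b c d) = mat-≡ (first a c) (first b d) (second a c) (second b d)
  where first : ∀ x y → + 1 * x + + 0 * y ≡ x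
        first = solve-∀
        second : ∀ x y → + 0 * x + + 1 * y ≡ y
        second = solve-∀

det-⊗ : ∀ A B → det (A ⊗ B) ≡ det A * det B
det-⊗ (mat a b c d) (mat e f g h) = ring a b c d e f g h
  where ring : ∀ a b c d e f g h → (a * e + b * g) * (c * f + d * h) - (a * f + b * h) * (c * e + d * g) ≡ (a * d - b * c) * (e * h - f * g)
        ring = solve-∀

infix 4 _≡M[_]_
record _≡M[_]_ (A : Mat) (n : ℕ) (B : Mat) : Set where
  constructor cm
  field
    at₁₁ : m₁₁ A ≡[ n ] m₁₁ B
    at₁₂ : m₁₂ A ≡[ n ] m₁₂ B
    at₂₁ : m₂₁ A ≡[ n ] m₂₁ B
    at₂₂ : m₂₂ A ≡[ n ] m₂₂ B

module _ {n : ℕ} where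

  cm-≡ : ∀ {A B} → A ≡ B → A ≡M[ n ] B
  cm-≡ refl = cm c-refl c-refl c-refl c-refl

  cm-refl : ∀ {A} → A ≡M[ n ] A
  cm-refl = cm-≡ refl

  cm-sym : ∀ {A B} → A ≡M[ n ] B → B ≡M[ n ] A
  cm-sym (cm p q r s) = cm (c-sym p) (c-sym q) (c-sym r) (c-sym s)

  cm-trans : ∀ {A B C} → A ≡M[ n ] B → B ≡M[ n ] C → A ≡M[ n ] C
  cm-trans (cm p q r s) (cm p' q' r' s') = cm (c-trans p p') (c-trans q q') (c-trans r r') (c-trans s s')

  cm-⊕ : ∀ {A A' B B'} → A ≡M[ n ] A' → B ≡M[ n ] B' → A ⊕ B ≡M[ n ] A' ⊕ B'
  cm-⊕ (cm p q r s) (cm p' q' r' s') = cm (c-+ p p') (c-+ q q') (c-+ r r') (c-+ s s')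

  cm-⊗ : ∀ {A A' B B'} → A ≡M[ n ] A' → B ≡M[ n ] B' → A ⊗ B ≡M[ n ] A' ⊗ B'
  cm-⊗ (cm p q r s) (cm p' q' r' s') =
    cm (c-+ (c-* p p') (c-* q r')) (c-+ (c-* p q') (c-* q s')) (c-+ (c-* r p') (c-* s r')) (c-+ (c-* r q') (c-* s s'))

  cm-⋆ : ∀ c {A B} → A ≡M[ n ] B → c ⋆ A ≡M[ n ] c ⋆ B
  cm-⋆ c (cm p q r s) = cm (c-* (c-refl {x = c}) p) (c-* (c-refl {x = c}) q) (c-* (c-refl {x = c}) r) (c-* (c-refl {x = c}) s)

  det-cong : ∀ {A B} → A ≡M[ n ] B → det A ≡[ n ] det B
  det-cong (cm p q r s) = c-+ (c-* p s) (c-neg (c-* q r))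

  decompose : ∀ {A B} → A ≡M[ n ] B → Σ Mat λ Q → A ≡ B ⊕ pow2 n ⋆ Q
  decompose (cm (by q₁ e₁) (by q₂ e₂) (by q₃ e₃) (by q₄ e₄)) = mat q₁ q₂ q₃ q₄ , mat-≡ e₁ e₂ e₃ e₄

Mat-mod : ℕ → Setoid _ _
Mat-mod n = record
  { Carrier = Mat ; _≈_ = λ A B → A ≡M[ n ] B
  ; isEquivalence = record { refl = cm-refl ; sym = cm-sym ; trans = cm-trans } }

cm-weaken : ∀ k {n A B} → A ≡M[ k ℕ.+ n ] B → A ≡M[ n ] B
cm-weaken k (cm p q r s) = cm (c-weaken k p) (c-weaken k q) (c-weaken k r) (c-weaken k s)

cm-scale : ∀ {k} n {A B} → A ≡M[ k ] B → pow2 n ⋆ A ≡M[ k ℕ.+ n ] pow2 n ⋆ B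
cm-scale n (cm p q r s) = cm (c-scale n p) (c-scale n q) (c-scale n r) (c-scale n s)

cm-absorb : ∀ {n} k X Q → X ⊕ pow2 (n ℕ.+ k) ⋆ Q ≡M[ n ] X
cm-absorb {n} k X Q = cm (absorb (m₁₁ X) (m₁₁ Q)) (absorb (m₁₂ X) (m₁₂ Q)) (absorb (m₂₁ X) (m₂₁ Q)) (absorb (m₂₂ X) (m₂₂ Q))
  where absorb : ∀ x q → x + pow2 (n ℕ.+ k) * q ≡[ n ] x
        absorb x q = by (pow2 k * q) (cong (λ p → x + p) (trans (cong (_* q) (pow2-+ n k)) (ℤP.*-assoc (pow2 n) (pow2 k) q)))

cm-scalar : ∀ {n t t'} X → t ≡[ n ] t' → t ⋆ X ≡M[ n ] t' ⋆ X
cm-scalar X e = cm (c-* e c-refl) (c-* e c-refl) (c-* e c-refl) (c-* e c-refl)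

⋆-identity : ∀ X → + 1 ⋆ X ≡ X
⋆-identity X = mat-≡ (ℤP.*-identityˡ (m₁₁ X)) (ℤP.*-identityˡ (m₁₂ X)) (ℤP.*-identityˡ (m₂₁ X)) (ℤP.*-identityˡ (m₂₂ X))

near : ℤ → Mat → Mat
near c X = 1M ⊕ c ⋆ X

nearI : ℕ → Mat → Mat
nearI n = near (pow2 n)

near-⊗ : ∀ c X Y → near c X ⊗ near c Y ≡ near c (X ⊕ Y ⊕ c ⋆ (X ⊗ Y))
near-⊗ c (mat x₁ x₂ x₃ x₄) (mat y₁ y₂ y₃ y₄) =
  mat-≡ (e₁₁ c x₁ x₂ y₁ y₃) (e₁₂ c x₁ x₂ y₂ y₄) (e₂₁ c x₃ x₄ y₁ y₃) (e₂₂ c x₃ x₄ y₂ y₄)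
  where
  e₁₁ : ∀ c x₁ x₂ y₁ y₃ → (+ 1 + c * x₁) * (+ 1 + c * y₁) + (+ 0 + c * x₂) * (+ 0 + c * y₃) ≡ + 1 + c * (x₁ + y₁ + c * (x₁ * y₁ + x₂ * y₃))
  e₁₁ = solve-∀
  e₁₂ : ∀ c x₁ x₂ y₂ y₄ → (+ 1 + c * x₁) * (+ 0 + c * y₂) + (+ 0 + c * x₂) * (+ 1 + c * y₄) ≡ + 0 + c * (x₂ + y₂ + c * (x₁ * y₂ + x₂ * y₄))
  e₁₂ = solve-∀
  e₂₁ : ∀ c x₃ x₄ y₁ y₃ → (+ 0 + c * x₃) * (+ 1 + c * y₁) + (+ 1 + c * x₄) * (+ 0 + c * y₃) ≡ + 0 + c * (x₃ + y₃ + c * (x₃ * y₁ + x₄ * y₃))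
  e₂₁ = solve-∀
  e₂₂ : ∀ c x₃ x₄ y₂ y₄ → (+ 0 + c * x₃) * (+ 0 + c * y₂) + (+ 1 + c * x₄) * (+ 1 + c * y₄) ≡ + 1 + c * (x₄ + y₄ + c * (x₃ * y₂ + x₄ * y₄))
  e₂₂ = solve-∀

near-square : ∀ {t c c'} → c ≡ + 2 * t → c' ≡ + 2 * c → ∀ Z → near c Z ⊗ near c Z ≡ near c' (Z ⊕ t ⋆ (Z ⊗ Z))
near-square {t} refl refl Z = trans (near-⊗ (+ 2 * t) Z Z)
  (mat-≡ (rescale t (+ 1) (m₁₁ Z) _) (rescale t (+ 0) (m₁₂ Z) _) (rescale t (+ 0) (m₂₁ Z) _) (rescale t (+ 1) (m₂₂ Z) _))
  where rescale : ∀ t δ z w → δ + (+ 2 * t) * (z + z + (+ 2 * t) * w) ≡ δ + (+ 2 * (+ 2 * t)) * (z + t * w)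
        rescale = solve-∀

near-absorb : ∀ c X Q → near c X ⊕ (+ 2 * c) ⋆ Q ≡ near c (X ⊕ + 2 ⋆ Q)
near-absorb c X Q = mat-≡ (absorb c (+ 1) (m₁₁ X) _) (absorb c (+ 0) (m₁₂ X) _) (absorb c (+ 0) (m₂₁ X) _) (absorb c (+ 1) (m₂₂ X) _)
  where absorb : ∀ c δ x q → (δ + c * x) + (+ 2 * c) * q ≡ δ + c * (x + + 2 * q)
        absorb = solve-∀

det-near : ∀ c X → det (near c X) ≡ + 1 + c * (trace X + c * det X)
det-near c (mat x₁ x₂ x₃ x₄) = ring c x₁ x₂ x₃ x₄
  where ring : ∀ c x₁ x₂ x₃ x₄ → (+ 1 + c * x₁) * (+ 1 + c * x₄) - (+ 0 + c * x₂) * (+ 0 + c * x₃) ≡ + 1 + c * ((x₁ + x₄) + c * (x₁ * x₄ - x₂ * x₃))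
        ring = solve-∀

nearI-cong : ∀ {k} n {X Y} → X ≡M[ k ] Y → nearI n X ≡M[ k ℕ.+ n ] nearI n Y
nearI-cong n {X} {Y} c = cm-⊕ {A = 1M} {1M} {pow2 n ⋆ X} {pow2 n ⋆ Y} cm-refl (cm-scale n c)

square-lift : ∀ m {A X} → A ≡M[ suc (suc m) ] nearI (suc m) X →
  A ⊗ A ≡M[ suc (suc (suc m)) ] nearI (suc (suc m)) (X ⊕ pow2 m ⋆ (X ⊗ X))
square-lift m {A} {X} A≡ = cm-trans (cm-≡ A²≡) (nearI-cong {1} (suc (suc m)) Z≡X′)
  where
  Q = proj₁ (decompose A≡)
  Z = X ⊕ + 2 ⋆ Q
  A≡Z : A ≡ nearI (suc m) Z
  A≡Z = trans (proj₂ (decompose A≡))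
    (trans (cong (λ p → nearI (suc m) X ⊕ p ⋆ Q) (pow2-suc (suc m))) (near-absorb (pow2 (suc m)) X Q))
  A²≡ : A ⊗ A ≡ nearI (suc (suc m)) (Z ⊕ pow2 m ⋆ (Z ⊗ Z))
  A²≡ = trans (cong (λ B → B ⊗ B) A≡Z) (near-square {pow2 m} (pow2-suc m) (pow2-suc (suc m)) Z)
  Z≡X : Z ≡M[ 1 ] X
  Z≡X = cm-absorb 0 X Q
  Z≡X′ : Z ⊕ pow2 m ⋆ (Z ⊗ Z) ≡M[ 1 ] X ⊕ pow2 m ⋆ (X ⊗ X)
  Z≡X′ = cm-⊕ Z≡X (cm-⋆ (pow2 m) (cm-⊗ Z≡X Z≡X))

product-mod8 : ∀ {A B X Y} → A ≡M[ 3 ] nearI 2 X → B ≡M[ 3 ] nearI 2 Y → A ⊗ B ≡M[ 3 ] nearI 2 (X ⊕ Y)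
product-mod8 {X = X} {Y} A≡ B≡ =
  cm-trans (cm-⊗ A≡ B≡) (cm-trans (cm-≡ (near-⊗ (pow2 2) X Y)) (nearI-cong {1} 2 (cm-absorb 1 (X ⊕ Y) (X ⊗ Y))))

-- det(I + 4X) ≡ 1 + 4 tr X (mod 8); so determinant 5 mod 8 forces an odd trace.
odd-trace : ∀ X → det (nearI 2 X) ≡[ 3 ] + 5 → trace X ≡[ 1 ] + 1
odd-trace X d≡5 = c-trans (c-sym T≡trace) (c-cancel 2 4T≡4)
  where
  -- det(I + 4X) = 1 + 4T, where T = tr X + 4 det X
  T = trace X + pow2 2 * det X
  T≡trace : T ≡[ 1 ] trace X
  T≡trace = c-trans (c-+ (c-refl {x = trace X}) (c-weaken 1 (c-multiple (det X)))) (c-≡ (ℤP.+-identityʳ (trace X)))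
  4T≡4 : pow2 2 * T ≡[ 1 ℕ.+ 2 ] pow2 2 * + 1
  4T≡4 = c-trans (c-≡ (sym (trans (cong (λ d → - + 1 + d) (det-near (pow2 2) X)) (cancel (pow2 2 * T))))) (c-+ (c-refl {x = - + 1}) d≡5)
    where cancel : ∀ u → - + 1 + (+ 1 + u) ≡ u
          cancel = solve-∀

level : M2 → ℕ → Mat
level g n = mat (+ seq (a g) n) (+ seq (b g) n) (+ seq (c g) n) (+ seq (d g) n)

entry-coh : ∀ x n k → + seq x (k ℕ.+ n) ≡[ n ] + seq x n
entry-coh x n zero    = c-refl
entry-coh x n (suc k) = c-trans (c-weaken k (fromCong (k ℕ.+ n) (coh x (k ℕ.+ n)))) (entry-coh x n k)

level-coh : ∀ g n k → level g (k ℕ.+ n) ≡M[ n ] level g n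
level-coh g n k = cm (entry-coh (a g) n k) (entry-coh (b g) n k) (entry-coh (c g) n k) (entry-coh (d g) n k)

level-toCongM : ∀ {n g h} → level g n ≡M[ n ] level h n → CongM n g h
level-toCongM {n} (cm p q r s) = toCong n p , toCong n q , toCong n r , toCong n s

pos-sumOfProducts : ∀ x y z w → + (x ℕ.* y ℕ.+ z ℕ.* w) ≡ + x * + y + + z * + w
pos-sumOfProducts x y z w = trans (ℤP.pos-+ (x ℕ.* y) (z ℕ.* w)) (cong₂ _+_ (ℤP.pos-* x y) (ℤP.pos-* z w))

sumOfProducts : ℤ₂ → ℤ₂ → ℤ₂ → ℤ₂ → ℤ₂
sumOfProducts x y z w = mkℤ₂ (λ n → seq x n ℕ.* seq y n ℕ.+ seq z n ℕ.* seq w n) coherent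
  where
  coherent : ∀ n → Cong n (seq x (suc n) ℕ.* seq y (suc n) ℕ.+ seq z (suc n) ℕ.* seq w (suc n))
                          (seq x n ℕ.* seq y n ℕ.+ seq z n ℕ.* seq w n)
  coherent n = toCong n (subst₂ (λ u v → u ≡[ n ] v)
    (sym (pos-sumOfProducts (seq x (suc n)) (seq y (suc n)) (seq z (suc n)) (seq w (suc n))))
    (sym (pos-sumOfProducts (seq x n) (seq y n) (seq z n) (seq w n)))
    (c-+ (c-* (entry-coh x n 1) (entry-coh y n 1)) (c-* (entry-coh z n 1) (entry-coh w n 1))))

mul : M2 → M2 → M2
mul g h = mkM2 (sumOfProducts (a g) (a h) (b g) (c h)) (sumOfProducts (a g) (b h) (b g) (d h))
               (sumOfProducts (c g) (a h) (d g) (c h)) (sumOfProducts (c g) (b h) (d g) (d h))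

mul-realises-· : ∀ g h → toSM (mul g h) ≈M (g · h)
mul-realises-· g h = (λ _ → refl) , (λ _ → refl) , (λ _ → refl) , (λ _ → refl)

level-mul : ∀ g h n → level (mul g h) n ≡ level g n ⊗ level h n
level-mul g h n = mat-≡ (pos-sumOfProducts (at a g) (at a h) (at b g) (at c h)) (pos-sumOfProducts (at a g) (at b h) (at b g) (at d h))
                        (pos-sumOfProducts (at c g) (at a h) (at d g) (at c h)) (pos-sumOfProducts (at c g) (at b h) (at d g) (at d h))
  where at : (M2 → ℤ₂) → M2 → ℕ
        at entry x = seq (entry x) n

level-inverse : ∀ g k → (g · k) ≈M ISM → ∀ n → level g n ⊗ level k n ≡M[ n ] 1M
level-inverse g k (p , q , r , s) n =
  cm (subst (λ u → u ≡[ n ] + 1) (pos-sumOfProducts (at a g) (at a k) (at b g) (at c k)) (fromCong n (p n)))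
     (subst (λ u → u ≡[ n ] + 0) (pos-sumOfProducts (at a g) (at b k) (at b g) (at d k)) (fromCong n (q n)))
     (subst (λ u → u ≡[ n ] + 0) (pos-sumOfProducts (at c g) (at a k) (at d g) (at c k)) (fromCong n (r n)))
     (subst (λ u → u ≡[ n ] + 1) (pos-sumOfProducts (at c g) (at b k) (at d g) (at d k)) (fromCong n (s n)))
  where at : (M2 → ℤ₂) → M2 → ℕ
        at entry x = seq (entry x) n

det-level : ∀ {g u} → HasDet g u → ∀ n → det (level g n) ≡[ n ] + seq u n
det-level {g} {u} hasDet n =
  c-trans (c-≡ (cong (_- B * C) (sym (ℤP.pos-* (seq (a g) n) (seq (d g) n)))))
  (c-trans (c-+ (fromCong n (hasDet n)) (c-refl {x = - (B * C)}))
  (c-≡ (trans (cong (_- B * C) (trans (ℤP.pos-+ (seq u n) _) (cong (λ t → + seq u n + t) (ℤP.pos-* (seq (b g) n) (seq (c g) n)))))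
              (cancel (+ seq u n) (B * C)))))
  where
  B = + seq (b g) n
  C = + seq (c g) n
  cancel : ∀ x y → x + y - y ≡ x
  cancel = solve-∀

-- Matrices modulo 4 with natural entries, the form in which Red4Surj speaks about GL₂(ℤ/4).
record Mat4 : Set where
  constructor m4
  field e₁₁ e₁₂ e₂₁ e₂₂ : ℕ
open Mat4

toMat : Mat4 → Mat
toMat M = mat (+ e₁₁ M) (+ e₁₂ M) (+ e₂₁ M) (+ e₂₂ M)

infixl 7 _⊗₄_
_⊗₄_ : Mat4 → Mat4 → Mat4
M ⊗₄ N = m4 (e₁₁ M ℕ.* e₁₁ N ℕ.+ e₁₂ M ℕ.* e₂₁ N) (e₁₁ M ℕ.* e₁₂ N ℕ.+ e₁₂ M ℕ.* e₂₂ N)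
            (e₂₁ M ℕ.* e₁₁ N ℕ.+ e₂₂ M ℕ.* e₂₁ N) (e₂₁ M ℕ.* e₁₂ N ℕ.+ e₂₂ M ℕ.* e₂₂ N)

toMat-⊗ : ∀ M N → toMat (M ⊗₄ N) ≡ toMat M ⊗ toMat N
toMat-⊗ M N = mat-≡ (pos-sumOfProducts (e₁₁ M) (e₁₁ N) (e₁₂ M) (e₂₁ N)) (pos-sumOfProducts (e₁₁ M) (e₁₂ N) (e₁₂ M) (e₂₂ N))
                    (pos-sumOfProducts (e₂₁ M) (e₁₁ N) (e₂₂ M) (e₂₁ N)) (pos-sumOfProducts (e₂₁ M) (e₁₂ N) (e₂₂ M) (e₂₂ N))

cong? : ∀ n x y → Dec (Cong n x y)
cong? n x y = ℕ._%_ x (2 ^ n) {{ℕP.m^n≢0 2 n}} ℕ.≟ ℕ._%_ y (2 ^ n) {{ℕP.m^n≢0 2 n}}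

SameMod4 : Mat4 → Mat4 → Set
SameMod4 M N = Cong 2 (e₁₁ M) (e₁₁ N) × Cong 2 (e₁₂ M) (e₁₂ N) × Cong 2 (e₂₁ M) (e₂₁ N) × Cong 2 (e₂₂ M) (e₂₂ N)

sameMod4? : ∀ M N → Dec (SameMod4 M N)
sameMod4? M N = cong? 2 (e₁₁ M) (e₁₁ N) ×-dec cong? 2 (e₁₂ M) (e₁₂ N) ×-dec cong? 2 (e₂₁ M) (e₂₁ N) ×-dec cong? 2 (e₂₂ M) (e₂₂ N)

toMat-same : ∀ {M N} → SameMod4 M N → toMat M ≡M[ 2 ] toMat N
toMat-same (p , q , r , s) = cm (fromCong 2 p) (fromCong 2 q) (fromCong 2 r) (fromCong 2 s)

InverseMod4 : Mat4 → Mat4 → Set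
InverseMod4 N N' = SameMod4 (N ⊗₄ N') (m4 1 0 0 1) × SameMod4 (N' ⊗₄ N) (m4 1 0 0 1)

invMod4 : ∀ {N N'} → InverseMod4 N N' → InvMod4 (e₁₁ N) (e₁₂ N) (e₂₁ N) (e₂₂ N)
invMod4 {N' = N'} inv = e₁₁ N' , e₁₂ N' , e₂₁ N' , e₂₂ N' , inv

-- det N ≡ 1 (mod 2ⁿ), phrased without subtraction in ℕ as e₁₁e₂₂ ≡ 1 + e₁₂e₂₁.
DetOne : ℕ → Mat4 → Set
DetOne n N = Cong n (e₁₁ N ℕ.* e₂₂ N) (1 ℕ.+ e₁₂ N ℕ.* e₂₁ N)

detOne-shift : ∀ N → (+ (e₁₁ N ℕ.* e₂₂ N) ≡ det (toMat N) + + (e₁₂ N ℕ.* e₂₁ N))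
                   × (+ (1 ℕ.+ e₁₂ N ℕ.* e₂₁ N) ≡ + 1 + + (e₁₂ N ℕ.* e₂₁ N))
detOne-shift N = trans (ℤP.pos-* (e₁₁ N) (e₂₂ N))
                       (trans (shift (+ e₁₁ N * + e₂₂ N) (+ e₁₂ N * + e₂₁ N)) (cong (λ t → det (toMat N) + t) (sym (ℤP.pos-* (e₁₂ N) (e₂₁ N)))))
               , ℤP.pos-+ 1 (e₁₂ N ℕ.* e₂₁ N)
  where shift : ∀ u v → u ≡ (u - v) + v
        shift = solve-∀

detOne⇒ : ∀ {n} N → DetOne n N → det (toMat N) ≡[ n ] + 1
detOne⇒ {n} N one = c-trans (c-≡ (unshift (det (toMat N)) t))
  (c-trans (c-+ (subst₂ (λ u v → u ≡[ n ] v) (proj₁ (detOne-shift N)) (proj₂ (detOne-shift N)) (fromCong n one)) (c-refl {x = - t}))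
           (c-≡ (sym (unshift (+ 1) t))))
  where t = + (e₁₂ N ℕ.* e₂₁ N)
        unshift : ∀ u v → u ≡ (u + v) + - v
        unshift = solve-∀

⇒detOne : ∀ {n} N → det (toMat N) ≡[ n ] + 1 → DetOne n N
⇒detOne {n} N det≡1 = toCong n (subst₂ (λ u v → u ≡[ n ] v) (sym (proj₁ (detOne-shift N))) (sym (proj₂ (detOne-shift N)))
  (c-+ det≡1 (c-refl {x = + (e₁₂ N ℕ.* e₂₁ N)})))

sgn₂ : ℕ → ℕ → ℕ → ℕ → Sign
sgn₂ α β γ δ = permSign (λ i → code ((α ℕ.* vx i ℕ.+ β ℕ.* vy i) ℕ.% 2) ((γ ℕ.* vx i ℕ.+ δ ℕ.* vy i) ℕ.% 2))

Admissible : Mat4 → Set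
Admissible M = (sgn₂ (e₁₁ M ℕ.% 2) (e₁₂ M ℕ.% 2) (e₂₁ M ℕ.% 2) (e₂₂ M ℕ.% 2) ≡ Sign.+) × DetOne 2 M

-- A certificate that M ≡ N₁² N₂² (mod 4) with N₁, N₂ invertible of odd determinant.
record Certificate : Set where
  constructor cert
  field N₁ N₁' N₂ N₂' : Mat4

Valid : Mat4 → Certificate → Set
Valid M (cert N₁ N₁' N₂ N₂') = InverseMod4 N₁ N₁' × InverseMod4 N₂ N₂' × DetOne 1 N₁ × DetOne 1 N₂
                             × SameMod4 ((N₁ ⊗₄ N₁) ⊗₄ (N₂ ⊗₄ N₂)) M

valid? : ∀ M C → Dec (Valid M C)
valid? M (cert N₁ N₁' N₂ N₂') =
  inverse? N₁ N₁' ×-dec inverse? N₂ N₂' ×-dec detOne? 1 N₁ ×-dec detOne? 1 N₂ ×-dec sameMod4? ((N₁ ⊗₄ N₁) ⊗₄ (N₂ ⊗₄ N₂)) M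
  where
  inverse? : ∀ N N' → Dec (InverseMod4 N N')
  inverse? N N' = sameMod4? (N ⊗₄ N') (m4 1 0 0 1) ×-dec sameMod4? (N' ⊗₄ N) (m4 1 0 0 1)
  detOne? : ∀ n N → Dec (DetOne n N)
  detOne? n N = cong? n (e₁₁ N ℕ.* e₂₂ N) (1 ℕ.+ e₁₂ N ℕ.* e₂₁ N)

certificate : Mat4 → Certificate
certificate (m4 0 1 3 1) = cert (m4 0 1 3 0) (m4 0 3 1 0) (m4 1 1 3 2) (m4 2 1 3 3)
certificate (m4 0 1 3 3) = cert (m4 0 1 1 0) (m4 0 1 1 0) (m4 1 1 3 0) (m4 0 3 1 1)
certificate (m4 0 3 1 1) = cert (m4 0 1 3 0) (m4 0 3 1 0) (m4 1 1 3 0) (m4 0 3 1 1)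
certificate (m4 0 3 1 3) = cert (m4 0 1 1 0) (m4 0 1 1 0) (m4 1 1 3 2) (m4 2 1 3 3)
certificate (m4 1 0 0 1) = cert (m4 0 1 1 0) (m4 0 1 1 0) (m4 0 1 1 0) (m4 0 1 1 0)
certificate (m4 1 0 2 1) = cert (m4 0 1 1 0) (m4 0 1 1 0) (m4 1 0 1 1) (m4 1 0 3 1)
certificate (m4 1 1 1 2) = cert (m4 0 1 1 0) (m4 0 1 1 0) (m4 0 1 1 1) (m4 3 1 1 0)
certificate (m4 1 1 3 0) = cert (m4 0 1 1 1) (m4 3 1 1 0) (m4 0 1 3 2) (m4 2 3 1 0)
certificate (m4 1 2 0 1) = cert (m4 0 1 1 0) (m4 0 1 1 0) (m4 1 1 0 1) (m4 1 3 0 1)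
certificate (m4 1 2 2 1) = cert (m4 0 1 1 0) (m4 0 1 1 0) (m4 0 1 1 2) (m4 2 1 1 0)
certificate (m4 1 3 1 0) = cert (m4 0 1 1 1) (m4 3 1 1 0) (m4 1 1 0 1) (m4 1 3 0 1)
certificate (m4 1 3 3 2) = cert (m4 0 1 1 0) (m4 0 1 1 0) (m4 0 1 1 3) (m4 1 1 1 0)
certificate (m4 2 1 1 1) = cert (m4 0 1 1 0) (m4 0 1 1 0) (m4 1 1 1 0) (m4 0 1 1 3)
certificate (m4 2 1 1 3) = cert (m4 0 1 3 0) (m4 0 3 1 0) (m4 1 1 1 2) (m4 2 3 3 1)
certificate (m4 2 3 3 1) = cert (m4 0 1 1 0) (m4 0 1 1 0) (m4 1 1 1 2) (m4 2 3 3 1)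
certificate (m4 2 3 3 3) = cert (m4 0 1 3 0) (m4 0 3 1 0) (m4 1 1 1 0) (m4 0 1 1 3)
certificate (m4 3 0 0 3) = cert (m4 0 1 1 0) (m4 0 1 1 0) (m4 0 1 3 0) (m4 0 3 1 0)
certificate (m4 3 0 2 3) = cert (m4 0 1 1 0) (m4 0 1 1 0) (m4 1 2 1 1) (m4 3 2 1 3)
certificate (m4 3 1 1 2) = cert (m4 0 1 1 1) (m4 3 1 1 0) (m4 1 0 1 1) (m4 1 0 3 1)
certificate (m4 3 1 3 0) = cert (m4 0 1 1 0) (m4 0 1 1 0) (m4 0 1 3 1) (m4 1 3 1 0)
certificate (m4 3 2 0 3) = cert (m4 0 1 1 0) (m4 0 1 1 0) (m4 1 1 2 1) (m4 3 1 2 3)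
certificate (m4 3 2 2 3) = cert (m4 0 1 1 0) (m4 0 1 1 0) (m4 0 1 3 2) (m4 2 3 1 0)
certificate (m4 3 3 1 0) = cert (m4 0 1 1 0) (m4 0 1 1 0) (m4 0 1 3 3) (m4 3 3 1 0)
certificate (m4 3 3 3 2) = cert (m4 0 1 1 1) (m4 3 1 1 0) (m4 0 1 3 0) (m4 0 3 1 0)
certificate _            = cert (m4 1 0 0 1) (m4 1 0 0 1) (m4 1 0 0 1) (m4 1 0 0 1)

residues : Fin 4 → Fin 4 → Fin 4 → Fin 4 → Mat4
residues p q r s = m4 (toℕ p) (toℕ q) (toℕ r) (toℕ s)

-- Every element of GL₂(ℤ/4) with sign +1 and determinant ≡ 1 (mod 4) is a product of two
-- squares N₁² N₂² of invertible matrices of odd determinant; checked over all 4⁴ residue matrices.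
squares-cover : ∀ p q r s → Admissible (residues p q r s) → Valid (residues p q r s) (certificate (residues p q r s))
squares-cover = toWitness {a? = all? λ p → all? λ q → all? λ r → all? λ s →
                              admissible? (residues p q r s) →-dec valid? (residues p q r s) (certificate (residues p q r s))} tt
  where admissible? : ∀ M → Dec (Admissible M)
        admissible? M = (sgn₂ (e₁₁ M ℕ.% 2) (e₁₂ M ℕ.% 2) (e₂₁ M ℕ.% 2) (e₂₂ M ℕ.% 2) SignP.≟ Sign.+)
                        ×-dec cong? 2 (e₁₁ M ℕ.* e₂₂ M) (1 ℕ.+ e₁₂ M ℕ.* e₂₁ M)

-- The 2-adic unit −1/3 = 1 + 4 + 4² + ⋯ ≡ 5 (mod 8), the determinant requested from SgnDetSurj.
geometric : ℕ → ℕ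
geometric zero    = 0
geometric (suc n) = geometric n ℕ.+ 2 ^ n ℕ.* 2 ^ n

geometric-suc : ∀ n → + geometric (suc n) ≡ + geometric n + pow2 n * pow2 n
geometric-suc n = trans (ℤP.pos-+ (geometric n) (2 ^ n ℕ.* 2 ^ n)) (cong (λ t → + geometric n + t) (ℤP.pos-* (2 ^ n) (2 ^ n)))

geometric-sum : ∀ n → + 3 * + geometric n + + 1 ≡ pow2 n * pow2 n
geometric-sum zero    = refl
geometric-sum (suc n) = begin
  + 3 * + geometric (suc n) + + 1                   ≡⟨ cong (λ t → + 3 * t + + 1) (geometric-suc n) ⟩
  + 3 * (+ geometric n + pow2 n * pow2 n) + + 1     ≡⟨ split (+ geometric n) (pow2 n) ⟩
  (+ 3 * + geometric n + + 1) + + 3 * (pow2 n * pow2 n)  ≡⟨ cong (λ t → t + + 3 * (pow2 n * pow2 n)) (geometric-sum n) ⟩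
  pow2 n * pow2 n + + 3 * (pow2 n * pow2 n)         ≡⟨ quadruple (pow2 n) ⟩
  (+ 2 * pow2 n) * (+ 2 * pow2 n)                   ≡⟨ sym (cong₂ _*_ (pow2-suc n) (pow2-suc n)) ⟩
  pow2 (suc n) * pow2 (suc n)                       ∎
  where
  open ≡-Reasoning
  split : ∀ g w → + 3 * (g + w * w) + + 1 ≡ (+ 3 * g + + 1) + + 3 * (w * w)
  split = solve-∀
  quadruple : ∀ w → w * w + + 3 * (w * w) ≡ (+ 2 * w) * (+ 2 * w)
  quadruple = solve-∀

minusThird : ℤ₂
minusThird = mkℤ₂ geometric (λ n → toCong n (by (pow2 n) (geometric-suc n)))

-- its inverse −3 = 9 · (−1/3)
minusThree : ℤ₂
minusThree = mkℤ₂ (λ n → 9 ℕ.* geometric n) coherent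
  where
  coherent : ∀ n → Cong n (9 ℕ.* geometric (suc n)) (9 ℕ.* geometric n)
  coherent n = toCong n (subst₂ (λ x y → x ≡[ n ] y) (sym (ℤP.pos-* 9 (geometric (suc n)))) (sym (ℤP.pos-* 9 (geometric n)))
                          (c-* (c-refl {x = + 9}) (by (pow2 n) (geometric-suc n))))

-- (−1/3)(−3) = (3g)² = (4ⁿ − 1)² ≡ 1 (mod 2ⁿ), where g = 1 + ⋯ + 4ⁿ⁻¹
minusThird-unit : IsUnit minusThird
minusThird-unit = minusThree , λ n → toCong n (by (pow2 n * pow2 n * pow2 n - + 2 * pow2 n) (product n))
  where
  product : ∀ n → + (geometric n ℕ.* (9 ℕ.* geometric n)) ≡ + 1 + pow2 n * (pow2 n * pow2 n * pow2 n - + 2 * pow2 n)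
  product n = begin
    + (geometric n ℕ.* (9 ℕ.* geometric n))            ≡⟨ trans (ℤP.pos-* (geometric n) _) (cong (+ geometric n *_) (ℤP.pos-* 9 (geometric n))) ⟩
    + geometric n * (+ 9 * + geometric n)              ≡⟨ square-of-triple (+ geometric n) ⟩
    ((+ 3 * + geometric n + + 1) - + 1) * ((+ 3 * + geometric n + + 1) - + 1)
                                                       ≡⟨ cong (λ t → (t - + 1) * (t - + 1)) (geometric-sum n) ⟩
    (pow2 n * pow2 n - + 1) * (pow2 n * pow2 n - + 1)  ≡⟨ expand (pow2 n) ⟩
    + 1 + pow2 n * (pow2 n * pow2 n * pow2 n - + 2 * pow2 n) ∎
    where
    open ≡-Reasoning
    square-of-triple : ∀ g → g * (+ 9 * g) ≡ ((+ 3 * g + + 1) - + 1) * ((+ 3 * g + + 1) - + 1)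
    square-of-triple = solve-∀
    expand : ∀ w → (w * w - + 1) * (w * w - + 1) ≡ + 1 + w * (w * w * w - + 2 * w)
    expand = solve-∀

module Lifting (H : M2 → Set) (CS : IsClosedSubgroup H) where
  open IsClosedSubgroup CS

  H-mul : ∀ {g h} → H g → H h → H (mul g h)
  H-mul {g} {h} Hg Hh = mul-cl g h (mul g h) Hg Hh (mul-realises-· g h)

  record InverseIn (h : M2) : Set where
    constructor inverseIn
    field
      h⁻¹       : M2
      H-h⁻¹     : H h⁻¹
      right-inv : ∀ n → level h n ⊗ level h⁻¹ n ≡M[ n ] 1M
      left-inv  : ∀ n → level h⁻¹ n ⊗ level h n ≡M[ n ] 1M

  inverse : ∀ {h} → H h → InverseIn h
  inverse {h} Hh with ⊆GL2 h Hh
  ... | k , hk , kh = inverseIn k (inv-cl h k Hh hk) (level-inverse h k hk) (level-inverse k h kh)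

  SurjectiveAt : ℕ → Set
  SurjectiveAt n = ∀ g → IsGL2 g → Σ M2 λ h → H h × level h n ≡M[ n ] level g n

  record Hits (n : ℕ) (X : Mat) : Set where
    constructor hit
    field
      witness : M2
      in-H    : H witness
      approx  : level witness (suc n) ≡M[ suc n ] nearI n X

  KernelSurjectiveAt : ℕ → Set
  KernelSurjectiveAt n = ∀ X → Hits n X

  -- From level 2 on, squaring carries the kernel at level n onto the kernel at level n+1
  -- (square-lift, the correction term 2ᵐ⁺¹X² being even).
  kernel-square : ∀ m → KernelSurjectiveAt (2 ℕ.+ m) → KernelSurjectiveAt (3 ℕ.+ m)
  kernel-square m hits X with hits X
  ... | hit k Hk k≡ = hit (mul k k) (H-mul Hk Hk)
    (cm-trans (cm-≡ (level-mul k k (4 ℕ.+ m)))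
    (cm-trans (square-lift (suc m) (cm-trans (level-coh k (3 ℕ.+ m) 1) k≡))
              (nearI-cong {1} (3 ℕ.+ m) (cm-absorb m X (X ⊗ X)))))

  -- One lifting step: if h ∈ H and h ≡ g (mod 2ⁿ), then h⁻¹g ≡ I + 2ⁿX (mod 2ⁿ⁺¹) for some X,
  -- and h m ≡ g (mod 2ⁿ⁺¹) for any m ∈ H hitting I + 2ⁿX.
  refine : ∀ n → KernelSurjectiveAt n → ∀ g {h} → H h → level h n ≡M[ n ] level g n →
           Σ M2 λ h' → H h' × level h' (suc n) ≡M[ suc n ] level g (suc n)
  refine n hits g {h} Hh h≡g = mul h m , H-mul Hh Hm , hm≡g
    where
    open InverseIn (inverse Hh)
    N = suc n
    h⁻¹g≡I : level h⁻¹ N ⊗ level g N ≡M[ n ] 1M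
    h⁻¹g≡I = cm-trans (cm-⊗ (level-coh h⁻¹ n 1) (cm-trans (level-coh g n 1) (cm-sym h≡g))) (left-inv n)
    X = proj₁ (decompose h⁻¹g≡I)
    open Hits (hits X) renaming (witness to m; in-H to Hm; approx to m≡)
    hm≡g : level (mul h m) N ≡M[ N ] level g N
    hm≡g = begin
      level (mul h m) N                         ≡⟨ level-mul h m N ⟩
      level h N ⊗ level m N                     ≈⟨ cm-⊗ (cm-refl {A = level h N}) m≡ ⟩
      level h N ⊗ nearI n X                     ≡⟨ cong (level h N ⊗_) (sym (proj₂ (decompose h⁻¹g≡I))) ⟩
      level h N ⊗ (level h⁻¹ N ⊗ level g N)     ≡⟨ sym (⊗-assoc (level h N) (level h⁻¹ N) (level g N)) ⟩
      (level h N ⊗ level h⁻¹ N) ⊗ level g N     ≈⟨ cm-⊗ (right-inv N) (cm-refl {A = level g N}) ⟩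
      1M ⊗ level g N                            ≡⟨ ⊗-identityˡ (level g N) ⟩
      level g N                                 ∎
      where open SetoidReasoning (Mat-mod N)

  level-step : ∀ n → KernelSurjectiveAt n → SurjectiveAt n → SurjectiveAt (suc n)
  level-step n hits surj g G with surj g G
  ... | h , Hh , h≡g = refine n hits g Hh h≡g

  lower : ∀ k {n} → SurjectiveAt (k ℕ.+ n) → SurjectiveAt n
  lower k {n} surj g G with surj g G
  ... | h , Hh , h≡g = h , Hh , cm-trans (cm-sym (level-coh h n k)) (cm-trans (cm-weaken k h≡g) (level-coh g n k))

  all-of-GL2 : KernelSurjectiveAt 2 → SurjectiveAt 2 → ∀ g → IsGL2 g → H g
  all-of-GL2 hits₂ surj₂ g G = closed g G approx
    where
    hitsAbove : ∀ m → KernelSurjectiveAt (2 ℕ.+ m)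
    hitsAbove zero    = hits₂
    hitsAbove (suc m) = kernel-square m (hitsAbove m)
    surjAbove : ∀ m → SurjectiveAt (2 ℕ.+ m)
    surjAbove zero    = surj₂
    surjAbove (suc m) = level-step (2 ℕ.+ m) (hitsAbove m) (surjAbove m)
    approx : ∀ n → Σ M2 λ h → H h × CongM n h g
    approx n = toCongM (lower 2 (surjAbove n) g G)
      where toCongM : (Σ M2 λ h → H h × level h n ≡M[ n ] level g n) → Σ M2 λ h → H h × CongM n h g
            toCongM (h , Hh , h≡g) = h , Hh , level-toCongM {n} {h} {g} h≡g

module Level2 (H : M2 → Set) (CS : IsClosedSubgroup H) (R4 : Red4Surj H) where
  open IsClosedSubgroup CS
  open Lifting H CS

  lift : ∀ N → InvMod4 (e₁₁ N) (e₁₂ N) (e₂₁ N) (e₂₂ N) → Σ M2 λ x → H x × level x 2 ≡M[ 2 ] toMat N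
  lift N inv = fromLift (R4 (e₁₁ N) (e₁₂ N) (e₂₁ N) (e₂₂ N) inv)
    where fromLift : (Σ M2 λ x → H x × Cong 2 (seq (a x) 2) (e₁₁ N) × Cong 2 (seq (b x) 2) (e₁₂ N)
                                      × Cong 2 (seq (c x) 2) (e₂₁ N) × Cong 2 (seq (d x) 2) (e₂₂ N))
                     → Σ M2 λ x → H x × level x 2 ≡M[ 2 ] toMat N
          fromLift (x , Hx , p , q , r , s) = x , Hx , cm (fromCong 2 p) (fromCong 2 q) (fromCong 2 r) (fromCong 2 s)

  surjective₂ : SurjectiveAt 2
  surjective₂ g (k , (p , q , r , s) , (p' , q' , r' , s')) =
    lift (m4 (seq (a g) 2) (seq (b g) 2) (seq (c g) 2) (seq (d g) 2))
         (seq (a k) 2 , seq (b k) 2 , seq (c k) 2 , seq (d k) 2 , (p 2 , q 2 , r 2 , s 2) , (p' 2 , q' 2 , r' 2 , s' 2))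

  0M : Mat
  0M = mat (+ 0) (+ 0) (+ 0) (+ 0)

  hits-zero : Hits 2 0M
  hits-zero = hit I₂ has-one cm-refl

  hits-⊕ : ∀ {X Y} → Hits 2 X → Hits 2 Y → Hits 2 (X ⊕ Y)
  hits-⊕ {X} {Y} (hit x Hx x≡) (hit y Hy y≡) = hit (mul x y) (H-mul Hx Hy) (cm-trans (cm-≡ (level-mul x y 3)) (product-mod8 {X = X} {Y} x≡ y≡))

  hits-mod2 : ∀ {X Y} → X ≡M[ 1 ] Y → Hits 2 X → Hits 2 Y
  hits-mod2 {X} {Y} X≡Y (hit x Hx x≡) = hit x Hx (cm-trans x≡ (nearI-cong {1} 2 {X} {Y} X≡Y))

  -- t X is ≡ 0 or ≡ X (mod 2) according to the parity of t
  hits-⋆ : ∀ {X} → Hits 2 X → ∀ t → Hits 2 (t ⋆ X)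
  hits-⋆ {X} hX t with c-parity t
  ... | inj₁ even = hits-mod2 (cm-sym (cm-scalar X even)) hits-zero
  ... | inj₂ odd  = hits-mod2 (cm-sym (cm-trans (cm-scalar X odd) (cm-≡ (⋆-identity X)))) hX

  hits-square : ∀ M N → InvMod4 (e₁₁ M) (e₁₂ M) (e₂₁ M) (e₂₂ M) → toMat M ≡M[ 2 ] nearI 1 N →
                Hits 2 (N ⊕ pow2 0 ⋆ (N ⊗ N))
  hits-square M N inv M≡ = square (lift M inv)
    where square : (Σ M2 λ x → H x × level x 2 ≡M[ 2 ] toMat M) → Hits 2 (N ⊕ pow2 0 ⋆ (N ⊗ N))
          square (x , Hx , x≡) = hit (mul x x) (H-mul Hx Hx)
            (cm-trans (cm-≡ (level-mul x x 3)) (square-lift 0 {X = N} (cm-trans (level-coh x 2 1) (cm-trans x≡ M≡))))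

  E₁₁ E₁₂ E₂₁ E₂₂ Ones : Mat
  E₁₁ = mat (+ 1) (+ 0) (+ 0) (+ 0)
  E₁₂ = mat (+ 0) (+ 1) (+ 0) (+ 0)
  E₂₁ = mat (+ 0) (+ 0) (+ 1) (+ 0)
  E₂₂ = mat (+ 0) (+ 0) (+ 0) (+ 1)
  Ones = mat (+ 1) (+ 1) (+ 1) (+ 1)

  -- E₁₂ = N + N² for the nilpotent N = E₁₂; I + 2N = (1 2; 0 1) is an involution mod 4
  hits-E₁₂ : Hits 2 E₁₂
  hits-E₁₂ = hits-square (m4 1 2 0 1) E₁₂ (1 , 2 , 0 , 1 , (refl , refl , refl , refl) , (refl , refl , refl , refl)) cm-refl

  -- likewise with N = E₂₁
  hits-E₂₁ : Hits 2 E₂₁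
  hits-E₂₁ = hits-square (m4 1 0 2 1) E₂₁ (1 , 0 , 2 , 1 , (refl , refl , refl , refl) , (refl , refl , refl , refl)) cm-refl

  -- Ones = N + N² for N = (0 1; 1 0), and I + 2N = (1 2; 2 1) is an involution mod 4
  hits-Ones : Hits 2 Ones
  hits-Ones = hits-square (m4 1 2 2 1) (mat (+ 0) (+ 1) (+ 1) (+ 0)) (1 , 2 , 2 , 1 , (refl , refl , refl , refl) , (refl , refl , refl , refl)) cm-refl

  OddTraceHit : Set
  OddTraceHit = Σ Mat λ X → Hits 2 X × trace X ≡[ 1 ] + 1

  -- E₁₂, E₂₁, Ones span the trace-zero matrices mod 2, so adding a suitable combination of them
  -- to a matrix of odd trace gives E₁₁.
  hits-E₁₁ : OddTraceHit → Hits 2 E₁₁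
  hits-E₁₁ (mat x₁ x₂ x₃ x₄ , hX , tr) = hits-mod2 W≡E₁₁
    (hits-⊕ (hits-⊕ (hits-⊕ (hits-⊕ (hits-⊕ hX (hits-⋆ hits-E₁₂ x₂)) (hits-⋆ hits-E₂₁ x₃)) (hits-⋆ hits-Ones x₄))
                    (hits-⋆ hits-E₁₂ x₄)) (hits-⋆ hits-E₂₁ x₄))
    where
    W≡E₁₁ : mat x₁ x₂ x₃ x₄ ⊕ x₂ ⋆ E₁₂ ⊕ x₃ ⋆ E₂₁ ⊕ x₄ ⋆ Ones ⊕ x₄ ⋆ E₁₂ ⊕ x₄ ⋆ E₂₁ ≡M[ 1 ] E₁₁
    W≡E₁₁ = cm (c-trans (c-≡ (entry₁₁ x₁ x₂ x₃ x₄)) tr) (by (x₂ + x₄) (entry₁₂ x₁ x₂ x₃ x₄)) (by (x₃ + x₄) (entry₂₁ x₁ x₂ x₃ x₄)) (by x₄ (entry₂₂ x₁ x₂ x₃ x₄))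
      where
      entry₁₁ : ∀ x₁ x₂ x₃ x₄ → x₁ + x₂ * + 0 + x₃ * + 0 + x₄ * + 1 + x₄ * + 0 + x₄ * + 0 ≡ x₁ + x₄
      entry₁₁ = solve-∀
      entry₁₂ : ∀ x₁ x₂ x₃ x₄ → x₂ + x₂ * + 1 + x₃ * + 0 + x₄ * + 1 + x₄ * + 1 + x₄ * + 0 ≡ + 0 + + 2 * (x₂ + x₄)
      entry₁₂ = solve-∀
      entry₂₁ : ∀ x₁ x₂ x₃ x₄ → x₃ + x₂ * + 0 + x₃ * + 1 + x₄ * + 1 + x₄ * + 0 + x₄ * + 1 ≡ + 0 + + 2 * (x₃ + x₄)
      entry₂₁ = solve-∀
      entry₂₂ : ∀ x₁ x₂ x₃ x₄ → x₄ + x₂ * + 0 + x₃ * + 0 + x₄ * + 1 + x₄ * + 0 + x₄ * + 0 ≡ + 0 + + 2 * x₄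
      entry₂₂ = solve-∀

  -- With E₁₁, E₁₂, E₂₁ and E₂₂ = E₁₁ + E₁₂ + E₂₁ + Ones (mod 2), every X is hit.
  hits-all : OddTraceHit → KernelSurjectiveAt 2
  hits-all odd (mat y₁ y₂ y₃ y₄) = hits-mod2 (cm-≡ (W≡Y y₁ y₂ y₃ y₄))
    (hits-⊕ (hits-⊕ (hits-⊕ (hits-⋆ hits-E₁₁′ y₁) (hits-⋆ hits-E₁₂ y₂)) (hits-⋆ hits-E₂₁ y₃)) (hits-⋆ hits-E₂₂ y₄))
    where
    hits-E₁₁′ : Hits 2 E₁₁
    hits-E₁₁′ = hits-E₁₁ odd
    hits-E₂₂ : Hits 2 E₂₂
    hits-E₂₂ = hits-mod2 (cm (by (+ 1) refl) (by (+ 1) refl) (by (+ 1) refl) c-refl)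
                         (hits-⊕ (hits-⊕ (hits-⊕ hits-E₁₁′ hits-E₁₂) hits-E₂₁) hits-Ones)
    W≡Y : ∀ y₁ y₂ y₃ y₄ → y₁ ⋆ E₁₁ ⊕ y₂ ⋆ E₁₂ ⊕ y₃ ⋆ E₂₁ ⊕ y₄ ⋆ E₂₂ ≡ mat y₁ y₂ y₃ y₄
    W≡Y y₁ y₂ y₃ y₄ = mat-≡ (entry₁₁ y₁ y₂ y₃ y₄) (entry₁₂ y₁ y₂ y₃ y₄) (entry₂₁ y₁ y₂ y₃ y₄) (entry₂₂ y₁ y₂ y₃ y₄)
      where
      entry₁₁ : ∀ y₁ y₂ y₃ y₄ → y₁ * + 1 + y₂ * + 0 + y₃ * + 0 + y₄ * + 0 ≡ y₁
      entry₁₁ = solve-∀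
      entry₁₂ : ∀ y₁ y₂ y₃ y₄ → y₁ * + 0 + y₂ * + 1 + y₃ * + 0 + y₄ * + 0 ≡ y₂
      entry₁₂ = solve-∀
      entry₂₁ : ∀ y₁ y₂ y₃ y₄ → y₁ * + 0 + y₂ * + 0 + y₃ * + 1 + y₄ * + 0 ≡ y₃
      entry₂₁ = solve-∀
      entry₂₂ : ∀ y₁ y₂ y₃ y₄ → y₁ * + 0 + y₂ * + 0 + y₃ * + 0 + y₄ * + 1 ≡ y₄
      entry₂₂ = solve-∀

  residue : ℤ₂ → Fin 4
  residue x = fromℕ< (ℕD.m%n<n (seq x 2) 4)

  residue-≡ : ∀ x → + toℕ (residue x) ≡[ 2 ] + seq x 2
  residue-≡ x = fromCong 2 {toℕ (residue x)} {seq x 2} (trans (cong (ℕ._% 4) (toℕ-fromℕ< (ℕD.m%n<n (seq x 2) 4))) (ℕD.m%n%n≡m%n (seq x 2) 4))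

  residue-bit : ∀ x → toℕ (residue x) ℕ.% 2 ≡ bit x
  residue-bit x = trans (cong (ℕ._% 2) (toℕ-fromℕ< (ℕD.m%n<n (seq x 2) 4))) (trans (ℕD.m∣n⇒o%n%m≡o%m 2 4 (seq x 2) (divides 2 refl)) (coh x 1))

  residues-of : M2 → Mat4
  residues-of g = residues (residue (a g)) (residue (b g)) (residue (c g)) (residue (d g))

  residues-≡ : ∀ g → toMat (residues-of g) ≡M[ 2 ] level g 2
  residues-≡ g = cm (residue-≡ (a g)) (residue-≡ (b g)) (residue-≡ (c g)) (residue-≡ (d g))

  admissible : ∀ g → sgn g ≡ Sign.+ → HasDet g minusThird → Admissible (residues-of g)
  admissible g sg dg = sign , ⇒detOne (residues-of g) (c-trans (det-cong (residues-≡ g)) (c-trans (det-level {g} {minusThird} dg 2) five≡one))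
    where
    five≡one : + 5 ≡[ 2 ] + 1
    five≡one = by (+ 1) refl
    sign : sgn₂ (toℕ (residue (a g)) ℕ.% 2) (toℕ (residue (b g)) ℕ.% 2) (toℕ (residue (c g)) ℕ.% 2) (toℕ (residue (d g)) ℕ.% 2) ≡ Sign.+
    sign rewrite residue-bit (a g) | residue-bit (b g) | residue-bit (c g) | residue-bit (d g) = sg

  -- If y, g ∈ H agree mod 4, det y ≡ 1 and det g ≡ 5 (mod 8), then y⁻¹g ∈ H is ≡ I + 4X (mod 8)
  -- with det(I + 4X) ≡ 5, i.e. tr X odd.
  quotient-hit : ∀ {y g} → H y → H g → level y 3 ≡M[ 2 ] level g 3 →
    det (level y 3) ≡[ 3 ] + 1 → det (level g 3) ≡[ 3 ] + 5 → OddTraceHit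
  quotient-hit {y} {g} Hy Hg y≡g dety detg =
    X , hit (mul y⁻¹ g) (H-mul H-y⁻¹ Hg) (cm-≡ (trans (level-mul y⁻¹ g 3) K⊗G≡)) , odd-trace X detX
    where
    open InverseIn (inverse Hy) renaming (h⁻¹ to y⁻¹; H-h⁻¹ to H-y⁻¹)
    K = level y⁻¹ 3
    G = level g 3
    K⊗G≡I : K ⊗ G ≡M[ 2 ] 1M
    K⊗G≡I = cm-trans (cm-⊗ (cm-refl {A = K}) (cm-sym y≡g)) (cm-weaken 1 (left-inv 3))
    X = proj₁ (decompose K⊗G≡I)
    K⊗G≡ : K ⊗ G ≡ nearI 2 X
    K⊗G≡ = proj₂ (decompose K⊗G≡I)
    -- det y⁻¹ ≡ det y · det y⁻¹ = det (y y⁻¹) ≡ 1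
    detK : det K ≡[ 3 ] + 1
    detK = c-trans (c-≡ (sym (ℤP.*-identityˡ (det K))))
           (c-trans (c-* (c-sym dety) (c-refl {x = det K}))
           (c-trans (c-≡ (sym (det-⊗ (level y 3) K))) (det-cong (right-inv 3))))
    detX : det (nearI 2 X) ≡[ 3 ] + 5
    detX = c-trans (c-≡ (trans (cong det (sym K⊗G≡)) (det-⊗ K G))) (c-* detK detg)

  -- y = x₁² x₂² for lifts xᵢ of certified Nᵢ: y ≡ N₁² N₂² (mod 4), and det y ≡ 1 (mod 8)
  -- as a product of squares of odd numbers.
  square-product : ∀ M C → Valid M C → Σ M2 λ y → H y × level y 3 ≡M[ 2 ] toMat M × det (level y 3) ≡[ 3 ] + 1
  square-product M (cert N₁ N₁' N₂ N₂') (inv₁ , inv₂ , one₁ , one₂ , prod) = product (lift N₁ (invMod4 inv₁)) (lift N₂ (invMod4 inv₂))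
    where
    Lift : Mat4 → Set
    Lift N = Σ M2 λ x → H x × level x 2 ≡M[ 2 ] toMat N
    product : Lift N₁ → Lift N₂ → Σ M2 λ y → H y × level y 3 ≡M[ 2 ] toMat M × det (level y 3) ≡[ 3 ] + 1
    product (x₁ , Hx₁ , x₁≡) (x₂ , Hx₂ , x₂≡) =
      mul (mul x₁ x₁) (mul x₂ x₂) , H-mul (H-mul Hx₁ Hx₁) (H-mul Hx₂ Hx₂) , y≡M , dety
      where
      X₁ = level x₁ 3
      X₂ = level x₂ 3
      X₁≡ : X₁ ≡M[ 2 ] toMat N₁
      X₁≡ = cm-trans (level-coh x₁ 2 1) x₁≡
      X₂≡ : X₂ ≡M[ 2 ] toMat N₂
      X₂≡ = cm-trans (level-coh x₂ 2 1) x₂≡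
      level-y : level (mul (mul x₁ x₁) (mul x₂ x₂)) 3 ≡ (X₁ ⊗ X₁) ⊗ (X₂ ⊗ X₂)
      level-y = trans (level-mul (mul x₁ x₁) (mul x₂ x₂) 3) (cong₂ _⊗_ (level-mul x₁ x₁ 3) (level-mul x₂ x₂ 3))
      toMat-prod : toMat ((N₁ ⊗₄ N₁) ⊗₄ (N₂ ⊗₄ N₂)) ≡ (toMat N₁ ⊗ toMat N₁) ⊗ (toMat N₂ ⊗ toMat N₂)
      toMat-prod = trans (toMat-⊗ (N₁ ⊗₄ N₁) (N₂ ⊗₄ N₂)) (cong₂ _⊗_ (toMat-⊗ N₁ N₁) (toMat-⊗ N₂ N₂))
      y≡M : level (mul (mul x₁ x₁) (mul x₂ x₂)) 3 ≡M[ 2 ] toMat M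
      y≡M = cm-trans (cm-≡ level-y) (cm-trans (cm-⊗ (cm-⊗ X₁≡ X₁≡) (cm-⊗ X₂≡ X₂≡))
              (cm-trans (cm-≡ (sym toMat-prod)) (toMat-same prod)))
      odd : ∀ {x N} → level x 3 ≡M[ 2 ] toMat N → DetOne 1 N → det (level x 3) ≡[ 1 ] + 1
      odd {N = N} x≡ one = c-trans (det-cong (cm-weaken 1 x≡)) (detOne⇒ N one)
      dety : det (level (mul (mul x₁ x₁) (mul x₂ x₂)) 3) ≡[ 3 ] + 1
      dety = c-trans (c-≡ (trans (cong det level-y)
                   (trans (det-⊗ (X₁ ⊗ X₁) (X₂ ⊗ X₂)) (cong₂ _*_ (det-⊗ X₁ X₁) (det-⊗ X₂ X₂)))))
             (c-* (c-odd-square (odd {x₁} X₁≡ one₁)) (c-odd-square (odd {x₂} X₂≡ one₂)))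

  -- The element of odd trace: take g ∈ H with sgn g = +1 and det g = −1/3, write g ≡ N₁²N₂² (mod 4)
  -- and divide by the product of squares of lifts.
  odd-trace-element : SgnDetSurj H → OddTraceHit
  odd-trace-element SD = from-g (SD Sign.+ minusThird minusThird-unit)
    where
    from-g : (Σ M2 λ g → H g × (sgn g ≡ Sign.+) × HasDet g minusThird) → OddTraceHit
    from-g (g , Hg , sg , dg) = from-y (square-product (residues-of g) (certificate (residues-of g))
                                          (squares-cover (residue (a g)) (residue (b g)) (residue (c g)) (residue (d g)) (admissible g sg dg)))
      where
      from-y : (Σ M2 λ y → H y × level y 3 ≡M[ 2 ] toMat (residues-of g) × det (level y 3) ≡[ 3 ] + 1) →
               OddTraceHit
      from-y (y , Hy , y≡ , dety) =
        quotient-hit Hy Hg (cm-trans y≡ (cm-trans (residues-≡ g) (cm-sym (level-coh g 2 1)))) dety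
                     (c-trans (det-level {g} {minusThird} dg 3) (by (+ 2) refl))

corollary2p4 : (H : M2 → Set) → IsClosedSubgroup H → Red4Surj H → SgnDetSurj H →
    ∀ g → IsGL2 g → H g
corollary2p4 H CS R4 SD = all-of-GL2 (hits-all (odd-trace-element SD)) surjective₂
  where
  open Lifting H CS
  open Level2 H CS R4
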